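{- Let $G$ be a connected $K^3_3$-saturated graph of order $n\geq 6$. Then there exists $u\in V(G)$ such that $d_H(u)\neq 2$ for every subgraph $H$ of $G$ isomorphic to $K^2_3$ (i.e., $u$ is not the triangle vertex without a pendant neighbor in any copy of $K^2_3$ in $G$).
   Context: All graphs are finite and simple. For $s\in\{2,3\}$, the virus $K^s_3$ is the triangle $K_3$ with one pendant vertex attached to each of $s$ distinct triangle vertices. A graph $G$ is $K^3_3$-saturated if it contains no subgraph isomorphic to $K^3_3$ but $G+uv$ contains one for every pair of non-adjacent vertices $u,v$; a graph with fewer than $6$ vertices is not $K^3_3$-saturated by convention. -}

module Defs where

open import Data.Nat using (ℕ; _≥_)
open import Data.Fin using (Fin; zero; suc; _≟_)
open import Data.Bool using (Bool; true; false; _∨_; _∧_)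
open import Data.List using (List; []; _∷_)
open import Data.List.Relation.Unary.All using (All)
open import Data.Product using (Σ; _×_; _,_; ∃)
open import Relation.Binary.PropositionalEquality using (_≡_; _≢_)
open import Relation.Nullary using (¬_)
open import Relation.Nullary.Decidable using (⌊_⌋)
open import Function.Definitions using (Injective)
open import Data.Fin using (#_)

record Graph (n : ℕ) : Set where
  field
    adj    : Fin n → Fin n → Bool
    sym    : ∀ u v → adj u v ≡ adj v u
    irrefl : ∀ v → adj v v ≡ false
open Graph public

addEdge : ∀ {n} → (Fin n → Fin n → Bool) → Fin n → Fin n → (Fin n → Fin n → Bool)
addEdge a u v x y = a x y ∨ ((⌊ x ≟ u ⌋ ∧ ⌊ y ≟ v ⌋) ∨ (⌊ x ≟ v ⌋ ∧ ⌊ y ≟ u ⌋))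

-- Its image is a subgraph isomorphic to the pattern.
Embedding : ∀ {k n} → List (Fin k × Fin k) → (Fin n → Fin n → Bool) → (Fin k → Fin n) → Set
Embedding {k} {n} es a f =
  Injective _≡_ _≡_ f × All (λ e → a (f (Data.Product.proj₁ e)) (f (Data.Product.proj₂ e)) ≡ true) es

K33-edges : List (Fin 6 × Fin 6)
K33-edges = (# 0 , # 1) ∷ (# 1 , # 2) ∷ (# 0 , # 2) ∷ (# 0 , # 3) ∷ (# 1 , # 4) ∷ (# 2 , # 5) ∷ []

-- K₃² : triangle 0,1,2 ; pendant 3 at 0, 4 at 1. Vertex 2 is the unique vertex of degree 2.
K32-edges : List (Fin 5 × Fin 5)
K32-edges = (# 0 , # 1) ∷ (# 1 , # 2) ∷ (# 0 , # 2) ∷ (# 0 , # 3) ∷ (# 1 , # 4) ∷ []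

ContainsK33 : ∀ {n} → (Fin n → Fin n → Bool) → Set
ContainsK33 {n} a = ∃ λ (f : Fin 6 → Fin n) → Embedding K33-edges a f

K33-saturated : ∀ {n} → Graph n → Set
K33-saturated {n} G =
  n ≥ 6 ×
  ¬ ContainsK33 (adj G) ×
  (∀ u v → u ≢ v → adj G u v ≡ false → ContainsK33 (addEdge (adj G) u v))

data Walk {n : ℕ} (G : Graph n) : Fin n → Fin n → Set where
  here : ∀ {v} → Walk G v v
  step : ∀ {u w v} → adj G u w ≡ true → Walk G w v → Walk G u v

Connected : ∀ {n} → Graph n → Set
Connected {n} G = ∀ (u v : Fin n) → Walk G u v

K32-deg2 : Fin 5
K32-deg2 = # 2

-- Call the degree-2 vertex of a copy of K₃² its apex. Every neighbour
-- of an apex lies in its copy, since a fifth neighbour would be a third pendant, giving K₃³.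
-- If every vertex were an apex, a case analysis of the copies at the five vertices of one fixed
-- copy C shows that no edge leaves C; so C would be a component with five vertices, impossible
-- in a connected graph with at least six vertices.
module Submission where

open import Defs hiding (sym)
open import Data.Nat using (ℕ; _≥_; _<_; s≤s; z≤n)
open import Data.Nat.Properties using (≤-trans)
open import Data.Fin using (Fin; _≟_; fromℕ<)
open import Data.Fin.Properties using (any?; ¬∀⟶∃¬; pigeonhole; <⇒≢)
open import Data.Bool using (true)
open import Data.Bool.Properties using () renaming (_≟_ to _≟ᵇ_)
open import Data.List using (List; []; _∷_; length; lookup)
open import Data.List.Relation.Unary.Any as Any using (here; there; index)
open import Data.List.Relation.Unary.Any.Properties using (lookup-index)
open import Data.List.Relation.Unary.All as All using (All; []; _∷_)
open import Data.List.Membership.Propositional using (_∈_; _∉_)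
open import Data.List.Relation.Binary.Permutation.Propositional using (refl; prep; swap)
open import Data.List.Relation.Binary.Permutation.Propositional.Properties using (∈-resp-↭)
open import Data.Vec as Vec using (Vec; []; _∷_)
open import Data.Vec.Relation.Unary.All using ([]; _∷_)
open import Data.Vec.Relation.Unary.AllPairs using ([]; _∷_)
open import Data.Vec.Relation.Unary.Unique.Propositional using (Unique)
open import Data.Vec.Relation.Unary.Unique.Propositional.Properties using (lookup-injective)
open import Data.Product using (∃; ∃-syntax; _,_)
open import Data.Empty using (⊥; ⊥-elim)
open import Function using (_∘_)
open import Relation.Binary.PropositionalEquality
  using (_≡_; _≢_; refl; sym; trans; subst; cong; ≢-sym; module ≡-Reasoning)
open import Relation.Nullary using (¬_; Dec; contradiction)
open import Relation.Nullary.Decidable using (_×-dec_; ¬?; map′; decidable-stable)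

pattern 1st = here refl
pattern 2nd = there 1st
pattern 3rd = there 2nd
pattern 4th = there 3rd
pattern 5th = there 4th

∉⇒≢ : {A : Set} {x y : A} {xs : List A} → x ∉ xs → y ∈ xs → x ≢ y
∉⇒≢ x∉ y∈ refl = x∉ y∈

∈-swapped : {A : Set} {a b u x y w : A} → w ∈ b ∷ a ∷ u ∷ y ∷ x ∷ [] → w ∈ a ∷ b ∷ u ∷ x ∷ y ∷ []
∈-swapped = ∈-resp-↭ (swap _ _ (prep _ (swap _ _ refl)))

missing-vertex : ∀ {n} (xs : List (Fin n)) → length xs < n → ∃ λ w → w ∉ xs
missing-vertex {n} xs |xs|<n = ¬∀⟶∃¬ n (_∈ xs) (λ w → Any.any? (w ≟_) xs) λ all∈ →
  let i , j , i<j , same-index = pigeonhole |xs|<n (index ∘ all∈)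
  in <⇒≢ i<j (begin
       i                          ≡⟨ lookup-index (all∈ i) ⟩
       lookup xs (index (all∈ i)) ≡⟨ cong (lookup xs) same-index ⟩
       lookup xs (index (all∈ j)) ≡⟨ sym (lookup-index (all∈ j)) ⟩
       j                          ∎)
  where open ≡-Reasoning

no-three-distinct-in-pair : {A : Set} {p q v₁ v₂ v₃ : A} →
                            v₁ ∈ p ∷ q ∷ [] → v₂ ∈ p ∷ q ∷ [] → v₃ ∈ p ∷ q ∷ [] →
                            v₁ ≢ v₂ → v₁ ≢ v₃ → v₂ ≢ v₃ → ⊥
no-three-distinct-in-pair 1st 1st _   v₁≢v₂ _     _     = v₁≢v₂ refl
no-three-distinct-in-pair 2nd 2nd _   v₁≢v₂ _     _     = v₁≢v₂ refl
no-three-distinct-in-pair 1st 2nd 1st _     v₁≢v₃ _     = v₁≢v₃ refl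
no-three-distinct-in-pair 1st 2nd 2nd _     _     v₂≢v₃ = v₂≢v₃ refl
no-three-distinct-in-pair 2nd 1st 1st _     _     v₂≢v₃ = v₂≢v₃ refl
no-three-distinct-in-pair 2nd 1st 2nd _     v₁≢v₃ _     = v₁≢v₃ refl

module _ {n : ℕ} (G : Graph n) where

  infix 4 _~_
  _~_ : Fin n → Fin n → Set
  v ~ w = adj G v w ≡ true

  private variable a b u x y p q s t v w z : Fin n

  ~-sym : v ~ w → w ~ v
  ~-sym {v} {w} v~w = trans (Graph.sym G w v) v~w

  ~-irrefl : ¬ v ~ v
  ~-irrefl {v} v~v = contradiction (trans (sym v~v) (irrefl G v)) λ ()

  ~⇒≢ : v ~ w → v ≢ w
  ~⇒≢ v~w refl = ~-irrefl v~w

  -- a and b are the bases, u is the apex, x and y are the pendants at a and b.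
  record IsK32 (a b u x y : Fin n) : Set where
    constructor mkK32
    field
      a~b : a ~ b
      b~u : b ~ u
      a~u : a ~ u
      a~x : a ~ x
      b~y : b ~ y
      x≢b : x ≢ b
      x≢u : x ≢ u
      y≢a : y ≢ a
      y≢u : y ≢ u
      y≢x : y ≢ x
  open IsK32

  vertices : IsK32 a b u x y → List (Fin n)
  vertices {a} {b} {u} {x} {y} _ = a ∷ b ∷ u ∷ x ∷ y ∷ []

  K32At : Fin n → Set
  K32At u = ∃[ a ] ∃[ b ] ∃[ x ] ∃[ y ] IsK32 a b u x y

  NeighboursIn : List (Fin n) → Fin n → Set
  NeighboursIn S v = ∀ {w} → v ~ w → w ∈ S

  Closed : List (Fin n) → Set
  Closed S = ∀ {v} → v ∈ S → NeighboursIn S v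

  swap-bases : IsK32 a b u x y → IsK32 b a u y x
  swap-bases c = mkK32 (~-sym (a~b c)) (a~u c) (b~u c) (b~y c) (a~x c)
                       (y≢a c) (y≢u c) (x≢b c) (x≢u c) (≢-sym (y≢x c))

  replace-pendant : IsK32 a b u x y → a ~ z → z ≢ b → z ≢ u → z ≢ y → IsK32 a b u z y
  replace-pendant c a~z z≢b z≢u z≢y =
    mkK32 (a~b c) (b~u c) (a~u c) a~z (b~y c) z≢b z≢u (y≢a c) (y≢u c) (≢-sym z≢y)

  outer-pendant : (c : IsK32 a b u x y) → a ~ z → z ∉ vertices c → IsK32 a b u z y
  outer-pendant c a~z z∉ = replace-pendant c a~z (∉⇒≢ z∉ 2nd) (∉⇒≢ z∉ 3rd) (∉⇒≢ z∉ 5th)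

  pendant∉ : IsK32 a b u x y → x ∉ a ∷ b ∷ u ∷ y ∷ []
  pendant∉ c 1st = ~-irrefl (a~x c)
  pendant∉ c 2nd = x≢b c refl
  pendant∉ c 3rd = x≢u c refl
  pendant∉ c 4th = y≢x c refl

  pendant-as-apex : IsK32 a b u x y → b ~ x → IsK32 a b x u y
  pendant-as-apex c b~x =
    mkK32 (a~b c) b~x (a~x c) (a~u c) (b~y c)
          (≢-sym (~⇒≢ (b~u c))) (≢-sym (x≢u c)) (y≢a c) (y≢x c) (y≢u c)

  triangle-on-pendants : IsK32 a b u x y → a ~ y → x ~ y → IsK32 a y x u b
  triangle-on-pendants c a~y x~y =
    mkK32 a~y (~-sym x~y) (a~x c) (a~u c) (~-sym (b~y c))
          (≢-sym (y≢u c)) (≢-sym (x≢u c)) (~⇒≢ (~-sym (a~b c))) (≢-sym (x≢b c)) (~⇒≢ (b~u c))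

  embedding⇒K32At : ∀ {f} → Embedding K32-edges (adj G) f → K32At (f K32-deg2)
  embedding⇒K32At {f} (inj , ab ∷ bu ∷ au ∷ ax ∷ by ∷ []) =
    _ , _ , _ , _ ,
    mkK32 ab bu au ax by (apart λ ()) (apart λ ()) (apart λ ()) (apart λ ()) (apart λ ())
    where
    apart : ∀ {i j} → i ≢ j → f i ≢ f j
    apart i≢j = i≢j ∘ inj

  K32+pendant⇒K33 : IsK32 a b u x y → u ~ w → w ∉ a ∷ b ∷ x ∷ y ∷ [] → ContainsK33 (adj G)
  K32+pendant⇒K33 {a} {b} {u} {x} {y} {w} c u~w w∉ =
    Vec.lookup copy , (λ {i} {j} → lookup-injective distinct i j) ,
    a~b c ∷ b~u c ∷ a~u c ∷ a~x c ∷ b~y c ∷ u~w ∷ []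
    where
    copy : Vec (Fin n) 6
    copy = a ∷ b ∷ u ∷ x ∷ y ∷ w ∷ []
    distinct : Unique copy
    distinct = (~⇒≢ (a~b c) ∷ ~⇒≢ (a~u c) ∷ ~⇒≢ (a~x c) ∷ ≢-sym (y≢a c) ∷ ≢-sym (∉⇒≢ w∉ 1st) ∷ [])
             ∷ (~⇒≢ (b~u c) ∷ ≢-sym (x≢b c) ∷ ~⇒≢ (b~y c) ∷ ≢-sym (∉⇒≢ w∉ 2nd) ∷ [])
             ∷ (≢-sym (x≢u c) ∷ ≢-sym (y≢u c) ∷ ~⇒≢ u~w ∷ [])
             ∷ (≢-sym (y≢x c) ∷ ≢-sym (∉⇒≢ w∉ 3rd) ∷ [])
             ∷ (≢-sym (∉⇒≢ w∉ 4th) ∷ [])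
             ∷ [] ∷ []

  walk-preserves-closed : ∀ {S} → Closed S → Walk G v w → v ∈ S → w ∈ S
  walk-preserves-closed closed here        v∈S = v∈S
  walk-preserves-closed closed (step e vw) v∈S = walk-preserves-closed closed vw (closed v∈S e)

  neighboursIn-swapped :
    NeighboursIn (b ∷ a ∷ u ∷ y ∷ x ∷ []) v → NeighboursIn (a ∷ b ∷ u ∷ x ∷ y ∷ []) v
  neighboursIn-swapped N v~w = ∈-swapped (N v~w)

  isK32? : ∀ a b u x y → Dec (IsK32 a b u x y)
  isK32? a b u x y =
    map′ (λ (ab , bu , au , ax , by , xb , xu , ya , yu , yx) → mkK32 ab bu au ax by xb xu ya yu yx)
         (λ c → a~b c , b~u c , a~u c , a~x c , b~y c , x≢b c , x≢u c , y≢a c , y≢u c , y≢x c)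
         (adjacent? a b ×-dec adjacent? b u ×-dec adjacent? a u ×-dec
          adjacent? a x ×-dec adjacent? b y ×-dec
          ¬? (x ≟ b) ×-dec ¬? (x ≟ u) ×-dec ¬? (y ≟ a) ×-dec ¬? (y ≟ u) ×-dec ¬? (y ≟ x))
    where
    adjacent? : ∀ v w → Dec (v ~ w)
    adjacent? v w = adj G v w ≟ᵇ true

  k32At? : ∀ u → Dec (K32At u)
  k32At? u = any? λ a → any? λ b → any? λ x → any? λ y → isK32? a b u x y

  module _ (K33-free : ¬ ContainsK33 (adj G)) where

    apex-neighbours : IsK32 a b u x y → NeighboursIn (a ∷ b ∷ x ∷ y ∷ []) u
    apex-neighbours c {w} u~w =
      decidable-stable (Any.any? (w ≟_) _) (K33-free ∘ K32+pendant⇒K33 c u~w)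

    apex-neighbours-except : IsK32 p q v s t → v ~ w → w ≢ p → w ≢ s → w ∈ q ∷ t ∷ []
    apex-neighbours-except e v~w w≢p w≢s with apex-neighbours e v~w
    ... | 1st = ⊥-elim (w≢p refl)
    ... | 2nd = 1st
    ... | 3rd = ⊥-elim (w≢s refl)
    ... | 4th = 2nd

    apex≁pendant : (c : IsK32 a b u x y) → a ~ z → z ∉ vertices c → ¬ u ~ x
    apex≁pendant c a~z z∉ u~x with apex-neighbours (outer-pendant c a~z z∉) u~x
    ... | 1st = ~-irrefl (a~x c)
    ... | 2nd = x≢b c refl
    ... | 3rd = z∉ 4th
    ... | 4th = y≢x c refl

    -- q and s lie in {b, y}, so the neighbours x and z of a are both forced to be t.
    no-outer-neighbour-at-base-u-base :
      (c : IsK32 a b u x y) → IsK32 u q a s t → a ~ z → z ∉ vertices c → ⊥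
    no-outer-neighbour-at-base-u-base {a} {b} {u} {x} {y} {t = t} c d a~z z∉ =
      ∉⇒≢ z∉ 4th (trans (forced-t a~z (∉⇒≢ z∉ 3rd) (z∉ ∘ by⊆S))
                        (sym (forced-t (a~x c) (x≢u c) x∉by)))
      where
      by⊆S : ∀ {w} → w ∈ b ∷ y ∷ [] → w ∈ vertices c
      by⊆S (here w≡b)  = there (here w≡b)
      by⊆S (there w∈y) = there (there (there (there w∈y)))
      x∉by : x ∉ b ∷ y ∷ []
      x∉by (here x≡b)         = x≢b c x≡b
      x∉by (there (here x≡y)) = y≢x c (sym x≡y)
      u-neighbour : ∀ {w} → u ~ w → w ≢ a → w ∈ b ∷ y ∷ []
      u-neighbour u~w w≢a =
        apex-neighbours-except c u~w w≢a λ w≡x → apex≁pendant c a~z z∉ (subst (u ~_) w≡x u~w)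
      forced-t : ∀ {w} → a ~ w → w ≢ u → w ∉ b ∷ y ∷ [] → w ≡ t
      forced-t a~w w≢u w∉
        with apex-neighbours-except d a~w w≢u (∉⇒≢ w∉ (u-neighbour (a~x d) (x≢u d)))
      ... | here w≡q         = ⊥-elim (∉⇒≢ w∉ (u-neighbour (a~b d) (~⇒≢ (b~u d))) w≡q)
      ... | there (here w≡t) = w≡t

    pendants-nonadjacent : IsK32 a b u v y → IsK32 a b u w y → b ~ v → ¬ v ~ w
    pendants-nonadjacent cv cw b~v v~w = pendant∉ cw (apex-neighbours (pendant-as-apex cv b~v) v~w)

    -- x and z are q and t in some order, and q ~ t.
    no-outer-neighbour-at-base-u-pendant-at-b :
      (c : IsK32 a b u x y) → IsK32 b q a u t → a ~ z → z ∉ vertices c → ⊥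
    no-outer-neighbour-at-base-u-pendant-at-b c d a~z z∉
      with apex-neighbours-except d (a~x c) (x≢b c) (x≢u c)
         | apex-neighbours-except d a~z (∉⇒≢ z∉ 2nd) (∉⇒≢ z∉ 3rd)
    ... | 1st | 1st = z∉ 4th
    ... | 2nd | 2nd = z∉ 4th
    ... | 1st | 2nd = pendants-nonadjacent c (outer-pendant c a~z z∉) (a~b d) (b~y d)
    ... | 2nd | 1st = pendants-nonadjacent (outer-pendant c a~z z∉) c (a~b d) (b~y d)

    no-outer-neighbour-at-base-u-pendant :
      (c : IsK32 a b u x y) → IsK32 p q a u t → a ~ z → z ∉ vertices c → ⊥
    no-outer-neighbour-at-base-u-pendant c d a~z z∉ with apex-neighbours c (~-sym (a~x d))
    ... | 1st = ~-irrefl (a~u d)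
    ... | 2nd = no-outer-neighbour-at-base-u-pendant-at-b c d a~z z∉
    ... | 3rd = apex≁pendant c a~z z∉ (~-sym (a~x d))
    ... | 4th = no-three-distinct-in-pair
                  (apex-neighbours-except d (a~b c) (~⇒≢ (b~y c)) (~⇒≢ (b~u c)))
                  (apex-neighbours-except d (a~x c) (≢-sym (y≢x c)) (x≢u c))
                  (apex-neighbours-except d a~z (∉⇒≢ z∉ 5th) (∉⇒≢ z∉ 3rd))
                  (≢-sym (x≢b c)) (≢-sym (∉⇒≢ z∉ 2nd)) (≢-sym (∉⇒≢ z∉ 4th))

    no-outer-neighbour-at-base :
      (c : IsK32 a b u x y) → IsK32 p q a s t → a ~ z → z ∉ vertices c → ⊥
    no-outer-neighbour-at-base c d a~z z∉ with apex-neighbours d (a~u c)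
    ... | 1st = no-outer-neighbour-at-base-u-base c d a~z z∉
    ... | 2nd = no-outer-neighbour-at-base-u-base c (swap-bases d) a~z z∉
    ... | 3rd = no-outer-neighbour-at-base-u-pendant c d a~z z∉
    ... | 4th = no-outer-neighbour-at-base-u-pendant c (swap-bases d) a~z z∉

    base-neighbours : (c : IsK32 a b u x y) → K32At a → NeighboursIn (vertices c) a
    base-neighbours c (_ , _ , _ , _ , d) {z} a~z =
      decidable-stable (Any.any? (z ≟_) _) (no-outer-neighbour-at-base c d a~z)

    apex-neighbours-within :
      ∀ {S} → IsK32 p q v s t → All (_∈ S) (p ∷ q ∷ s ∷ t ∷ []) → NeighboursIn S v
    apex-neighbours-within e inS v~w = All.lookup inS (apex-neighbours e v~w)

    apex-neighbours-in-copy : (c : IsK32 a b u x y) → NeighboursIn (vertices c) u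
    apex-neighbours-in-copy c = apex-neighbours-within c (1st ∷ 2nd ∷ 4th ∷ 5th ∷ [])

    -- Each case is contradictory or exhibits a copy with apex x inside vertices c.
    pendant-neighbours-a-base : (c : IsK32 a b u x y) → NeighboursIn (vertices c) a →
                                NeighboursIn (vertices c) b → IsK32 a q x s t →
                                NeighboursIn (vertices c) x
    pendant-neighbours-a-base c Na Nb e with Na (a~b e)
    ... | 1st = ⊥-elim (~-irrefl (a~b e))
    ... | 2nd = apex-neighbours-within e (1st ∷ 2nd ∷ Na (a~x e) ∷ Nb (b~y e) ∷ [])
    ... | 3rd =
      apex-neighbours-within e (1st ∷ 3rd ∷ Na (a~x e) ∷ apex-neighbours-in-copy c (b~y e) ∷ [])
    ... | 4th = ⊥-elim (~-irrefl (b~u e))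
    ... | 5th =
      apex-neighbours-within (triangle-on-pendants c (a~b e) (~-sym (b~u e)))
                             (1st ∷ 5th ∷ 3rd ∷ 2nd ∷ [])

    pendant-neighbours-a-pendant : (c : IsK32 a b u x y) → NeighboursIn (vertices c) a →
                                   NeighboursIn (vertices c) b → IsK32 p q x a t →
                                   NeighboursIn (vertices c) x
    pendant-neighbours-a-pendant c Na Nb e with Na (~-sym (a~x e))
    ... | 1st = ⊥-elim (~-irrefl (a~x e))
    ... | 2nd = apex-neighbours-within (pendant-as-apex c (a~u e)) (1st ∷ 2nd ∷ 3rd ∷ 5th ∷ [])
    ... | 4th = ⊥-elim (~-irrefl (a~u e))
    ... | 5th =
      apex-neighbours-within (triangle-on-pendants c (~-sym (a~x e)) (~-sym (a~u e)))
                             (1st ∷ 5th ∷ 3rd ∷ 2nd ∷ [])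
    ... | 3rd with apex-neighbours c (a~b e)
    ...   | 1st = ⊥-elim (x≢b e refl)
    ...   | 2nd = apex-neighbours-within e (3rd ∷ 2nd ∷ 1st ∷ Nb (b~y e) ∷ [])
    ...   | 3rd = ⊥-elim (~-irrefl (b~u e))
    ...   | 4th =
      apex-neighbours-within
        (replace-pendant (swap-bases e) (~-sym (b~y c))
                         (~⇒≢ (b~u c)) (≢-sym (x≢b c)) (~⇒≢ (~-sym (a~b c))))
        (5th ∷ 3rd ∷ 2nd ∷ 1st ∷ [])

    pendant-neighbours : (c : IsK32 a b u x y) → NeighboursIn (vertices c) a →
                         NeighboursIn (vertices c) b → K32At x →
                         NeighboursIn (vertices c) x
    pendant-neighbours c Na Nb (_ , _ , _ , _ , e) with apex-neighbours e (~-sym (a~x c))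
    ... | 1st = pendant-neighbours-a-base c Na Nb e
    ... | 2nd = pendant-neighbours-a-base c Na Nb (swap-bases e)
    ... | 3rd = pendant-neighbours-a-pendant c Na Nb e
    ... | 4th = pendant-neighbours-a-pendant c Na Nb (swap-bases e)

    copy-closed : (∀ v → K32At v) → (c : IsK32 a b u x y) → Closed (vertices c)
    copy-closed {a} {b} {u} {x} {y} apex c = closed
      where
      Na : NeighboursIn (vertices c) a
      Na = base-neighbours c (apex a)
      Nb : NeighboursIn (vertices c) b
      Nb = neighboursIn-swapped (base-neighbours (swap-bases c) (apex b))
      closed : Closed (vertices c)
      closed 1st = Na
      closed 2nd = Nb
      closed 3rd = apex-neighbours-in-copy c
      closed 4th = pendant-neighbours c Na Nb (apex x)
      closed 5th = neighboursIn-swapped (pendant-neighbours (swap-bases c)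
                     (neighboursIn-swapped Nb) (neighboursIn-swapped Na) (apex y))

    not-every-vertex-an-apex : Connected G → n ≥ 6 → ¬ (∀ v → K32At v)
    not-every-vertex-an-apex connected n≥6 apex =
      let v = fromℕ< (≤-trans (s≤s z≤n) n≥6)
          _ , _ , _ , _ , c = apex v
          w , w∉ = missing-vertex (vertices c) n≥6
      in w∉ (walk-preserves-closed (copy-closed apex c) (connected v w) 3rd)

lemma3p4 : (n : ℕ) (G : Graph n) → Connected G → K33-saturated G → n ≥ 6 →
    ∃ λ (u : Fin n) → ∀ (f : Fin 5 → Fin n) → Embedding K32-edges (adj G) f → f K32-deg2 ≢ u
lemma3p4 n G connected (_ , K33-free , _) n≥6 =
  let u , ¬apex = ¬∀⟶∃¬ n (K32At G) (k32At? G) (not-every-vertex-an-apex G K33-free connected n≥6)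
  in u , λ f embedding f₂≡u → ¬apex (subst (K32At G) f₂≡u (embedding⇒K32At G embedding))
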